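{- For any graphs $G_1$ and $G_2$ (not necessarily $P_4$-free) on disjoint vertex sets: \[\tau(G_1\cup G_2)=\tau(G_1)+\tau(G_2),\qquad \tau(G_1\vee G_2)=\min\{\tau(G_1)+|V(G_2)|,\ \tau(G_2)+|V(G_1)|\},\] \[\varsigma(G_1\cup G_2)=\varsigma(G_1)+\varsigma(G_2),\qquad \varsigma(G_1\vee G_2)=\min\{\varsigma(G_1)+|V(G_2)|,\ \varsigma(G_2)+|V(G_1)|,\ \tau(\overline{G_1})+\tau(\overline{G_2})\}.\]
   Context: Graphs are finite, simple, undirected. For vertex-disjoint $G_1=(V_1,E_1)$, $G_2=(V_2,E_2)$: the disjoint union is $G_1\cup G_2=(V_1\cup V_2,E_1\cup E_2)$ and the join is $G_1\vee G_2=(V_1\cup V_2,E_1\cup E_2\cup\{uv: u\in V_1,v\in V_2\})$. $\overline{G}$ is the complement of $G$. $\tau(G)$ is the minimum size of a vertex cover of $G$ (a set $S$ with $G-S$ edgeless). $\varsigma(G)$ is the minimum size of a cluster vertex deletion set of $G$ (a set $S$ such that every component of $G-S$ is a clique). -}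

module Defs where

open import Data.Nat using (ℕ; _+_; _≤_)
open import Data.Fin using (Fin; splitAt; _≟_)
open import Data.Fin.Subset using (Subset; _∈_; _∉_; ∣_∣)
open import Data.Bool using (Bool; true; false; not; if_then_else_)
open import Data.Sum using (_⊎_; inj₁; inj₂)
open import Data.Product using (Σ; _×_; _,_)
open import Relation.Nullary using (¬_; yes; no)
open import Relation.Binary.PropositionalEquality using (_≡_; refl; sym)

record Graph (n : ℕ) : Set where
  field
    adj    : Fin n → Fin n → Bool
    adj-sym    : ∀ u v → adj u v ≡ adj v u
    adj-irrefl : ∀ u → adj u u ≡ false
open Graph public

Edge : ∀ {n} → Graph n → Fin n → Fin n → Set
Edge G u v = adj G u v ≡ true

-- Mixed-pair adjacency on Fin (m + n): vertices of V₁ are `i ↑ˡ n`, of V₂ are `m ↑ʳ j`.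
sumAdj : ∀ {m n} → Graph m → Graph n → Bool → Fin (m + n) → Fin (m + n) → Bool
sumAdj {m} G H b u v with splitAt m u | splitAt m v
... | inj₁ a | inj₁ c = adj G a c
... | inj₂ a | inj₂ c = adj H a c
... | inj₁ _ | inj₂ _ = b
... | inj₂ _ | inj₁ _ = b

sumAdj-sym : ∀ {m n} (G : Graph m) (H : Graph n) b u v →
             sumAdj G H b u v ≡ sumAdj G H b v u
sumAdj-sym {m} G H b u v with splitAt m u | splitAt m v
... | inj₁ a | inj₁ c = adj-sym G a c
... | inj₂ a | inj₂ c = adj-sym H a c
... | inj₁ _ | inj₂ _ = refl
... | inj₂ _ | inj₁ _ = refl

sumAdj-irrefl : ∀ {m n} (G : Graph m) (H : Graph n) b u →
                sumAdj G H b u u ≡ false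
sumAdj-irrefl {m} G H b u with splitAt m u
... | inj₁ a = adj-irrefl G a
... | inj₂ a = adj-irrefl H a

_∪ᴳ_ : ∀ {m n} → Graph m → Graph n → Graph (m + n)
G ∪ᴳ H = record { adj = sumAdj G H false
                ; adj-sym = sumAdj-sym G H false
                ; adj-irrefl = sumAdj-irrefl G H false }

_∨ᴳ_ : ∀ {m n} → Graph m → Graph n → Graph (m + n)
G ∨ᴳ H = record { adj = sumAdj G H true
                ; adj-sym = sumAdj-sym G H true
                ; adj-irrefl = sumAdj-irrefl G H true }

compAdj : ∀ {n} → Graph n → Fin n → Fin n → Bool
compAdj G u v with u ≟ v
... | yes _ = false
... | no _  = not (adj G u v)

compAdj-sym : ∀ {n} (G : Graph n) u v → compAdj G u v ≡ compAdj G v u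
compAdj-sym G u v with u ≟ v | v ≟ u
... | yes _ | yes _ = refl
... | yes p | no q = Data.Empty.⊥-elim (q (sym p)) where import Data.Empty
... | no p | yes q = Data.Empty.⊥-elim (p (sym q)) where import Data.Empty
... | no _ | no _ rewrite adj-sym G u v = refl

compAdj-irrefl : ∀ {n} (G : Graph n) u → compAdj G u u ≡ false
compAdj-irrefl G u with u ≟ u
... | yes _ = refl
... | no p = Data.Empty.⊥-elim (p refl) where import Data.Empty

complement : ∀ {n} → Graph n → Graph n
complement G = record { adj = compAdj G ; adj-sym = compAdj-sym G ; adj-irrefl = compAdj-irrefl G }

IsVertexCover : ∀ {n} → Graph n → Subset n → Set
IsVertexCover G S = ∀ u v → Edge G u v → (u ∈ S) ⊎ (v ∈ S)

IsTau : ∀ {n} → Graph n → ℕ → Set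
IsTau {n} G k = Σ (Subset n) (λ S → IsVertexCover G S × ∣ S ∣ ≡ k)
              × (∀ (S : Subset n) → IsVertexCover G S → k ≤ ∣ S ∣)

data ReachOutside {n} (G : Graph n) (S : Subset n) : Fin n → Fin n → Set where
  here : ∀ {u} → u ∉ S → ReachOutside G S u u
  step : ∀ {u v w} → u ∉ S → Edge G u v → ReachOutside G S v w → ReachOutside G S u w

IsClusterDeletionSet : ∀ {n} → Graph n → Subset n → Set
IsClusterDeletionSet G S =
  ∀ u v → ReachOutside G S u v → ¬ (u ≡ v) → Edge G u v

IsVarsigma : ∀ {n} → Graph n → ℕ → Set
IsVarsigma {n} G k = Σ (Subset n) (λ S → IsClusterDeletionSet G S × ∣ S ∣ ≡ k)
                   × (∀ (S : Subset n) → IsClusterDeletionSet G S → k ≤ ∣ S ∣)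

-- Vertex covers and cluster deletion sets of G ⊕ H (union or join) restrict to such sets of G and
-- of H, and in the disjoint union they also combine, which gives both sum formulas.  In the join
-- every vertex of G is adjacent to every vertex of H, so a vertex cover that misses a vertex of H
-- contains all of G.  Cluster deletion sets are handled through the local characterisation
-- "G − S has no induced P₃": if a cluster deletion set S₁ ++ S₂ of the join spares a vertex j of
-- H, then any two non-adjacent survivors in G form an induced P₃ with j, so G − S₁ is complete,
-- i.e. S₁ is a vertex cover of the complement of G.  Hence such a set either contains all of one
-- side or consists of vertex covers of both complements, and each option is realised.
{-# OPTIONS --safe #-}
module Submission where

open import Defs
open import Data.Nat as ℕ using (ℕ; _+_; _⊓_; _≤_)
open import Data.Nat.Properties using (⊓-sel; m≤n⇒m⊓o≤n; m≤n⇒o⊓m≤n; +-mono-≤; +-comm)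
open import Data.Product using (_×_; Σ; ∃; _,_)
open import Data.Fin using (Fin; zero; suc; _↑ˡ_; _↑ʳ_; _≟_)
open import Data.Fin.Properties
  using (splitAt-↑ˡ; splitAt-↑ʳ; ↑ˡ-injective; ↑ʳ-injective; all?; ¬∀⟶∃¬)
open import Data.Fin.Subset using (Subset; _∈_; _∉_; _⊆_; ∣_∣; ⊤)
open import Data.Fin.Subset.Properties using (_∈?_; ∈⊤; ∣⊤∣≡n; p⊆q⇒∣p∣≤∣q∣)
open import Data.Vec using ([]; _∷_; _++_)
import Data.Vec as Vec
open import Data.Vec.Properties using (lookup-++ˡ; lookup-++ʳ; []=⇒lookup; lookup⇒[]=)
open import Data.Bool using (Bool; true; false; not)
open import Data.Bool.Properties using (not-injective)
open import Data.Sum using (_⊎_; inj₁; inj₂; [_,_]′)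
import Data.Sum as Sum
open import Data.Empty using (⊥-elim)
open import Relation.Nullary using (¬_; yes; no)
open import Relation.Binary.PropositionalEquality
  using (_≡_; _≢_; refl; sym; trans; cong; cong₂; subst)
open import Function using (_∘_)

private variable n : ℕ

⊤⊆-or-∉ : (p : Subset n) → ⊤ ⊆ p ⊎ ∃ (_∉ p)
⊤⊆-or-∉ {n} p with all? (_∈? p)
... | yes full = inj₁ (λ _ → full _)
... | no ¬full = inj₂ (¬∀⟶∃¬ n (_∈ p) (_∈? p) ¬full)

⊤⊆⇒n≤∣p∣ : {p : Subset n} → ⊤ ⊆ p → n ≤ ∣ p ∣
⊤⊆⇒n≤∣p∣ {n} {p} ⊤⊆p = subst (_≤ ∣ p ∣) (∣⊤∣≡n n) (p⊆q⇒∣p∣≤∣q∣ ⊤⊆p)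

∣p++q∣≡∣p∣+∣q∣ : ∀ {m} (p : Subset m) (q : Subset n) → ∣ p ++ q ∣ ≡ ∣ p ∣ + ∣ q ∣
∣p++q∣≡∣p∣+∣q∣ []          q = refl
∣p++q∣≡∣p∣+∣q∣ (true ∷ p)  q = cong ℕ.suc (∣p++q∣≡∣p∣+∣q∣ p q)
∣p++q∣≡∣p∣+∣q∣ (false ∷ p) q = ∣p++q∣≡∣p∣+∣q∣ p q

Attains : (Subset n → Set) → ℕ → Set
Attains {n} P k = Σ (Subset n) λ S → P S × ∣ S ∣ ≡ k

IsLowerBound : (Subset n → Set) → ℕ → Set
IsLowerBound P k = ∀ S → P S → k ≤ ∣ S ∣

IsMinimum : (Subset n → Set) → ℕ → Set
IsMinimum P k = Attains P k × IsLowerBound P k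

attains-⊓ : ∀ {P : Subset n → Set} {x y} → Attains P x → Attains P y → Attains P (x ⊓ y)
attains-⊓ {P = P} {x} {y} Px Py with ⊓-sel x y
... | inj₁ x⊓y≡x = subst (Attains P) (sym x⊓y≡x) Px
... | inj₂ x⊓y≡y = subst (Attains P) (sym x⊓y≡y) Py

CompleteOutside : Graph n → Subset n → Set
CompleteOutside G S = ∀ {u v} → u ∉ S → v ∉ S → u ≢ v → Edge G u v

P₃FreeOutside : Graph n → Subset n → Set
P₃FreeOutside G S =
  ∀ {u v w} → u ∉ S → v ∉ S → w ∉ S → Edge G u v → Edge G v w → u ≢ w → Edge G u w

edge-complement⁺ : {G : Graph n} {u v : Fin n} →
                   u ≢ v → adj G u v ≡ false → Edge (complement G) u v
edge-complement⁺ {u = u} {v} u≢v ¬uv with u ≟ v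
... | yes u≡v = ⊥-elim (u≢v u≡v)
... | no _    = cong not ¬uv

edge-complement⁻ : {G : Graph n} {u v : Fin n} →
                   Edge (complement G) u v → u ≢ v × adj G u v ≡ false
edge-complement⁻ {u = u} {v} uv with u ≟ v
... | no u≢v = u≢v , not-injective uv

module _ {G : Graph n} {S : Subset n} where

  reach-source∉ : ∀ {u v} → ReachOutside G S u v → u ∉ S
  reach-source∉ (here u∉S)     = u∉S
  reach-source∉ (step u∉S _ _) = u∉S

  reach-target∉ : ∀ {u v} → ReachOutside G S u v → v ∉ S
  reach-target∉ (here v∉S)   = v∉S
  reach-target∉ (step _ _ r) = reach-target∉ r

  cluster⇒p₃Free : IsClusterDeletionSet G S → P₃FreeOutside G S
  cluster⇒p₃Free cluster u∉S v∉S w∉S uv vw u≢w =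
    cluster _ _ (step u∉S uv (step v∉S vw (here w∉S))) u≢w

  p₃Free⇒cluster : P₃FreeOutside G S → IsClusterDeletionSet G S
  p₃Free⇒cluster free u .u (here _) u≢u = ⊥-elim (u≢u refl)
  p₃Free⇒cluster free u w (step {v = v} u∉S uv r) u≢w with v ≟ w
  ... | yes refl = uv
  ... | no v≢w   =
    free u∉S (reach-source∉ r) (reach-target∉ r) uv (p₃Free⇒cluster free v w r v≢w) u≢w

  complete⇒cluster : CompleteOutside G S → IsClusterDeletionSet G S
  complete⇒cluster complete = p₃Free⇒cluster λ u∉S _ w∉S _ _ u≢w → complete u∉S w∉S u≢w

  coverComplement⇒complete : IsVertexCover (complement G) S → CompleteOutside G S
  coverComplement⇒complete cover {u} {v} u∉S v∉S u≢v with adj G u v in uv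
  ... | true  = refl
  ... | false = ⊥-elim ([ u∉S , v∉S ]′ (cover u v (edge-complement⁺ u≢v uv)))

  complete⇒coverComplement : CompleteOutside G S → IsVertexCover (complement G) S
  complete⇒coverComplement complete u v uv with u ∈? S | v ∈? S
  ... | yes u∈S | _       = inj₁ u∈S
  ... | no _    | yes v∈S = inj₂ v∈S
  ... | no u∉S  | no v∉S  with edge-complement⁻ uv
  ...   | u≢v , ¬uv with () ← trans (sym (complete u∉S v∉S u≢v)) ¬uv

data Side (m n : ℕ) : Fin (m + n) → Set where
  left  : (i : Fin m) → Side m n (i ↑ˡ n)
  right : (j : Fin n) → Side m n (m ↑ʳ j)

side : ∀ m {n} (u : Fin (m + n)) → Side m n u
side ℕ.zero        u       = right u
side (ℕ.suc m)     zero    = left zero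
side (ℕ.suc m) {n} (suc u) with side m {n} u
... | left i  = left (suc i)
... | right j = right j

module _ {m n : ℕ} where

  module _ {p : Subset m} {q : Subset n} where

    ∈-++⁺ˡ : ∀ {i} → i ∈ p → i ↑ˡ n ∈ p ++ q
    ∈-++⁺ˡ {i} i∈p = lookup⇒[]= _ (p ++ q) (trans (lookup-++ˡ p q i) ([]=⇒lookup i∈p))

    ∈-++⁻ˡ : ∀ {i} → i ↑ˡ n ∈ p ++ q → i ∈ p
    ∈-++⁻ˡ {i} i∈pq = lookup⇒[]= i p (trans (sym (lookup-++ˡ p q i)) ([]=⇒lookup i∈pq))

    ∈-++⁺ʳ : ∀ {j} → j ∈ q → m ↑ʳ j ∈ p ++ q
    ∈-++⁺ʳ {j} j∈q = lookup⇒[]= _ (p ++ q) (trans (lookup-++ʳ p q j) ([]=⇒lookup j∈q))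

    ∈-++⁻ʳ : ∀ {j} → m ↑ʳ j ∈ p ++ q → j ∈ q
    ∈-++⁻ʳ {j} j∈pq = lookup⇒[]= j q (trans (sym (lookup-++ʳ p q j)) ([]=⇒lookup j∈pq))

  module _ {R : Subset (m + n) → Set} where

    attains-++ : ∀ (S : Subset m) (T : Subset n) {s t} →
                 R (S ++ T) → ∣ S ∣ ≡ s → ∣ T ∣ ≡ t → Attains R (s + t)
    attains-++ S T RST ∣S∣≡s ∣T∣≡t =
      S ++ T , RST , trans (∣p++q∣≡∣p∣+∣q∣ S T) (cong₂ _+_ ∣S∣≡s ∣T∣≡t)

    isLowerBound-++ : ∀ {k} → (∀ S T → R (S ++ T) → k ≤ ∣ S ∣ + ∣ T ∣) → IsLowerBound R k
    isLowerBound-++ {k} bound U RU with Vec.splitAt m U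
    ... | S , T , refl = subst (k ≤_) (sym (∣p++q∣≡∣p∣+∣q∣ S T)) (bound S T RU)

    isMinimum-++ : ∀ {P : Subset m → Set} {Q : Subset n → Set} {s t} →
                   (∀ {S T} → P S → Q T → R (S ++ T)) →
                   (∀ {S T} → R (S ++ T) → P S × Q T) →
                   IsMinimum P s → IsMinimum Q t → IsMinimum R (s + t)
    isMinimum-++ combine split ((S , PS , ∣S∣≡s) , minP) ((T , QT , ∣T∣≡t) , minQ) =
      attains-++ S T (combine PS QT) ∣S∣≡s ∣T∣≡t ,
      isLowerBound-++ λ S T RST → let PS , QT = split RST in +-mono-≤ (minP S PS) (minQ T QT)

  -- G ⊕[ false ] H and G ⊕[ true ] H unfold to G ∪ᴳ H and G ∨ᴳ H.
  _⊕[_]_ : Graph m → Bool → Graph n → Graph (m + n)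
  G ⊕[ b ] H = record
    { adj = sumAdj G H b ; adj-sym = sumAdj-sym G H b ; adj-irrefl = sumAdj-irrefl G H b }

  module _ {G : Graph m} {H : Graph n} where

    adj-⊕-ˡˡ : ∀ {b} i k → adj (G ⊕[ b ] H) (i ↑ˡ n) (k ↑ˡ n) ≡ adj G i k
    adj-⊕-ˡˡ i k rewrite splitAt-↑ˡ m i n | splitAt-↑ˡ m k n = refl

    adj-⊕-ʳʳ : ∀ {b} j l → adj (G ⊕[ b ] H) (m ↑ʳ j) (m ↑ʳ l) ≡ adj H j l
    adj-⊕-ʳʳ j l rewrite splitAt-↑ʳ m n j | splitAt-↑ʳ m n l = refl

    adj-⊕-ˡʳ : ∀ {b} i j → adj (G ⊕[ b ] H) (i ↑ˡ n) (m ↑ʳ j) ≡ b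
    adj-⊕-ˡʳ i j rewrite splitAt-↑ˡ m i n | splitAt-↑ʳ m n j = refl

    adj-⊕-ʳˡ : ∀ {b} j i → adj (G ⊕[ b ] H) (m ↑ʳ j) (i ↑ˡ n) ≡ b
    adj-⊕-ʳˡ j i rewrite splitAt-↑ʳ m n j | splitAt-↑ˡ m i n = refl

    edgeˡ⁺ : ∀ {b i k} → Edge G i k → Edge (G ⊕[ b ] H) (i ↑ˡ n) (k ↑ˡ n)
    edgeˡ⁺ = trans (adj-⊕-ˡˡ _ _)

    edgeˡ⁻ : ∀ {b} i k → Edge (G ⊕[ b ] H) (i ↑ˡ n) (k ↑ˡ n) → Edge G i k
    edgeˡ⁻ i k = trans (sym (adj-⊕-ˡˡ i k))

    edgeʳ⁺ : ∀ {b j l} → Edge H j l → Edge (G ⊕[ b ] H) (m ↑ʳ j) (m ↑ʳ l)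
    edgeʳ⁺ = trans (adj-⊕-ʳʳ _ _)

    edgeʳ⁻ : ∀ {b} j l → Edge (G ⊕[ b ] H) (m ↑ʳ j) (m ↑ʳ l) → Edge H j l
    edgeʳ⁻ j l = trans (sym (adj-⊕-ʳʳ j l))

    ∪-no-edgeˡʳ : ∀ i j → ¬ Edge (G ∪ᴳ H) (i ↑ˡ n) (m ↑ʳ j)
    ∪-no-edgeˡʳ i j e with () ← trans (sym (adj-⊕-ˡʳ i j)) e

    ∪-no-edgeʳˡ : ∀ j i → ¬ Edge (G ∪ᴳ H) (m ↑ʳ j) (i ↑ˡ n)
    ∪-no-edgeʳˡ j i e with () ← trans (sym (adj-⊕-ʳˡ j i)) e

    cover-restrictˡ : ∀ {b S T} → IsVertexCover (G ⊕[ b ] H) (S ++ T) → IsVertexCover G S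
    cover-restrictˡ cover i k ik = Sum.map ∈-++⁻ˡ ∈-++⁻ˡ (cover _ _ (edgeˡ⁺ ik))

    cover-restrictʳ : ∀ {b S T} → IsVertexCover (G ⊕[ b ] H) (S ++ T) → IsVertexCover H T
    cover-restrictʳ cover j l jl = Sum.map ∈-++⁻ʳ ∈-++⁻ʳ (cover _ _ (edgeʳ⁺ jl))

    cover-∪ : ∀ {S T} → IsVertexCover G S → IsVertexCover H T → IsVertexCover (G ∪ᴳ H) (S ++ T)
    cover-∪ coverG coverH u v uv with side m u | side m v
    ... | left i  | left k  = Sum.map ∈-++⁺ˡ ∈-++⁺ˡ (coverG i k (edgeˡ⁻ i k uv))
    ... | right j | right l = Sum.map ∈-++⁺ʳ ∈-++⁺ʳ (coverH j l (edgeʳ⁻ j l uv))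
    ... | left i  | right j = ⊥-elim (∪-no-edgeˡʳ i j uv)
    ... | right j | left i  = ⊥-elim (∪-no-edgeʳˡ j i uv)

    cover-++⊤ : ∀ {b S} → IsVertexCover G S → IsVertexCover (G ⊕[ b ] H) (S ++ ⊤)
    cover-++⊤ {S = S} coverG u v uv with side m u | side m v
    ... | left i  | left k  = Sum.map ∈-++⁺ˡ ∈-++⁺ˡ (coverG i k (edgeˡ⁻ i k uv))
    ... | right _ | _       = inj₁ (∈-++⁺ʳ {p = S} ∈⊤)
    ... | left _  | right _ = inj₂ (∈-++⁺ʳ {p = S} ∈⊤)

    cover-⊤++ : ∀ {b T} → IsVertexCover H T → IsVertexCover (G ⊕[ b ] H) (⊤ ++ T)
    cover-⊤++ {T = T} coverH u v uv with side m u | side m v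
    ... | right j | right l = Sum.map ∈-++⁺ʳ ∈-++⁺ʳ (coverH j l (edgeʳ⁻ j l uv))
    ... | left _  | _       = inj₁ (∈-++⁺ˡ {q = T} ∈⊤)
    ... | right _ | left _  = inj₂ (∈-++⁺ˡ {q = T} ∈⊤)

    cover-∨⇒⊤⊆ˡ : ∀ {S T} → IsVertexCover (G ∨ᴳ H) (S ++ T) → ∀ {j} → j ∉ T → ⊤ ⊆ S
    cover-∨⇒⊤⊆ˡ cover {j} j∉T {i} _ =
      [ ∈-++⁻ˡ , ⊥-elim ∘ j∉T ∘ ∈-++⁻ʳ ]′ (cover (i ↑ˡ n) (m ↑ʳ j) (adj-⊕-ˡʳ i j))

    p₃Free-restrictˡ : ∀ {b S T} → P₃FreeOutside (G ⊕[ b ] H) (S ++ T) → P₃FreeOutside G S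
    p₃Free-restrictˡ free {i} {j} {k} i∉S j∉S k∉S ij jk i≢k = edgeˡ⁻ i k
      (free (i∉S ∘ ∈-++⁻ˡ) (j∉S ∘ ∈-++⁻ˡ) (k∉S ∘ ∈-++⁻ˡ) (edgeˡ⁺ ij) (edgeˡ⁺ jk) (i≢k ∘ ↑ˡ-injective n i k))

    p₃Free-restrictʳ : ∀ {b S T} → P₃FreeOutside (G ⊕[ b ] H) (S ++ T) → P₃FreeOutside H T
    p₃Free-restrictʳ free {j} {k} {l} j∉T k∉T l∉T jk kl j≢l = edgeʳ⁻ j l
      (free (j∉T ∘ ∈-++⁻ʳ) (k∉T ∘ ∈-++⁻ʳ) (l∉T ∘ ∈-++⁻ʳ) (edgeʳ⁺ jk) (edgeʳ⁺ kl) (j≢l ∘ ↑ʳ-injective m j l))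

    p₃Free-∪ : ∀ {S T} → P₃FreeOutside G S → P₃FreeOutside H T → P₃FreeOutside (G ∪ᴳ H) (S ++ T)
    p₃Free-∪ freeG freeH {u} {v} {w} u∉ v∉ w∉ uv vw u≢w with side m u | side m v | side m w
    ... | left i  | left j  | left k  = edgeˡ⁺ (freeG {i} {j} {k}
      (u∉ ∘ ∈-++⁺ˡ) (v∉ ∘ ∈-++⁺ˡ) (w∉ ∘ ∈-++⁺ˡ) (edgeˡ⁻ i j uv) (edgeˡ⁻ j k vw) (u≢w ∘ cong (_↑ˡ n)))
    ... | right j | right k | right l = edgeʳ⁺ (freeH {j} {k} {l}
      (u∉ ∘ ∈-++⁺ʳ) (v∉ ∘ ∈-++⁺ʳ) (w∉ ∘ ∈-++⁺ʳ) (edgeʳ⁻ j k uv) (edgeʳ⁻ k l vw) (u≢w ∘ cong (m ↑ʳ_)))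
    ... | left i  | right j | _       = ⊥-elim (∪-no-edgeˡʳ i j uv)
    ... | right j | left i  | _       = ⊥-elim (∪-no-edgeʳˡ j i uv)
    ... | left _  | left i  | right j = ⊥-elim (∪-no-edgeˡʳ i j vw)
    ... | right _ | right j | left i  = ⊥-elim (∪-no-edgeʳˡ j i vw)

    p₃Free-++⊤ : ∀ {b S} → P₃FreeOutside G S → P₃FreeOutside (G ⊕[ b ] H) (S ++ ⊤)
    p₃Free-++⊤ {S = S} freeG {u} {v} {w} u∉ v∉ w∉ uv vw u≢w with side m u | side m v | side m w
    ... | left i  | left j  | left k  = edgeˡ⁺ (freeG {i} {j} {k}
      (u∉ ∘ ∈-++⁺ˡ) (v∉ ∘ ∈-++⁺ˡ) (w∉ ∘ ∈-++⁺ˡ) (edgeˡ⁻ i j uv) (edgeˡ⁻ j k vw) (u≢w ∘ cong (_↑ˡ n)))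
    ... | right _ | _       | _       = ⊥-elim (u∉ (∈-++⁺ʳ {p = S} ∈⊤))
    ... | _       | right _ | _       = ⊥-elim (v∉ (∈-++⁺ʳ {p = S} ∈⊤))
    ... | _       | _       | right _ = ⊥-elim (w∉ (∈-++⁺ʳ {p = S} ∈⊤))

    p₃Free-⊤++ : ∀ {b T} → P₃FreeOutside H T → P₃FreeOutside (G ⊕[ b ] H) (⊤ ++ T)
    p₃Free-⊤++ {T = T} freeH {u} {v} {w} u∉ v∉ w∉ uv vw u≢w with side m u | side m v | side m w
    ... | right j | right k | right l = edgeʳ⁺ (freeH {j} {k} {l}
      (u∉ ∘ ∈-++⁺ʳ) (v∉ ∘ ∈-++⁺ʳ) (w∉ ∘ ∈-++⁺ʳ) (edgeʳ⁻ j k uv) (edgeʳ⁻ k l vw) (u≢w ∘ cong (m ↑ʳ_)))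
    ... | left _  | _       | _       = ⊥-elim (u∉ (∈-++⁺ˡ {q = T} ∈⊤))
    ... | _       | left _  | _       = ⊥-elim (v∉ (∈-++⁺ˡ {q = T} ∈⊤))
    ... | _       | _       | left _  = ⊥-elim (w∉ (∈-++⁺ˡ {q = T} ∈⊤))

    complete-∨ : ∀ {S T} → CompleteOutside G S → CompleteOutside H T →
                 CompleteOutside (G ∨ᴳ H) (S ++ T)
    complete-∨ completeG completeH {u} {v} u∉ v∉ u≢v with side m u | side m v
    ... | left i  | left k  =
      edgeˡ⁺ (completeG {i} {k} (u∉ ∘ ∈-++⁺ˡ) (v∉ ∘ ∈-++⁺ˡ) (u≢v ∘ cong (_↑ˡ n)))
    ... | right j | right l =
      edgeʳ⁺ (completeH {j} {l} (u∉ ∘ ∈-++⁺ʳ) (v∉ ∘ ∈-++⁺ʳ) (u≢v ∘ cong (m ↑ʳ_)))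
    ... | left i  | right j = adj-⊕-ˡʳ i j
    ... | right j | left i  = adj-⊕-ʳˡ j i

    p₃Free-∨⇒completeˡ : ∀ {S T} → P₃FreeOutside (G ∨ᴳ H) (S ++ T) →
                         ∀ {j} → j ∉ T → CompleteOutside G S
    p₃Free-∨⇒completeˡ free {j} j∉T {i} {k} i∉S k∉S i≢k = edgeˡ⁻ i k
      (free (i∉S ∘ ∈-++⁻ˡ) (j∉T ∘ ∈-++⁻ʳ) (k∉S ∘ ∈-++⁻ˡ)
            (adj-⊕-ˡʳ i j) (adj-⊕-ʳˡ j k) (i≢k ∘ ↑ˡ-injective n i k))

    p₃Free-∨⇒completeʳ : ∀ {S T} → P₃FreeOutside (G ∨ᴳ H) (S ++ T) →
                         ∀ {i} → i ∉ S → CompleteOutside H T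
    p₃Free-∨⇒completeʳ free {i} i∉S {j} {l} j∉T l∉T j≢l = edgeʳ⁻ j l
      (free (j∉T ∘ ∈-++⁻ʳ) (i∉S ∘ ∈-++⁻ˡ) (l∉T ∘ ∈-++⁻ʳ)
            (adj-⊕-ʳˡ j i) (adj-⊕-ˡʳ i l) (j≢l ∘ ↑ʳ-injective m j l))

    cluster-restrictˡ : ∀ {b S T} → IsClusterDeletionSet (G ⊕[ b ] H) (S ++ T) →
                        IsClusterDeletionSet G S
    cluster-restrictˡ = p₃Free⇒cluster ∘ p₃Free-restrictˡ ∘ cluster⇒p₃Free

    cluster-restrictʳ : ∀ {b S T} → IsClusterDeletionSet (G ⊕[ b ] H) (S ++ T) →
                        IsClusterDeletionSet H T
    cluster-restrictʳ = p₃Free⇒cluster ∘ p₃Free-restrictʳ ∘ cluster⇒p₃Free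

    cluster-∪ : ∀ {S T} → IsClusterDeletionSet G S → IsClusterDeletionSet H T →
                IsClusterDeletionSet (G ∪ᴳ H) (S ++ T)
    cluster-∪ clusterG clusterH =
      p₃Free⇒cluster (p₃Free-∪ (cluster⇒p₃Free clusterG) (cluster⇒p₃Free clusterH))

    cluster-++⊤ : ∀ {b S} → IsClusterDeletionSet G S → IsClusterDeletionSet (G ⊕[ b ] H) (S ++ ⊤)
    cluster-++⊤ = p₃Free⇒cluster ∘ p₃Free-++⊤ ∘ cluster⇒p₃Free

    cluster-⊤++ : ∀ {b T} → IsClusterDeletionSet H T → IsClusterDeletionSet (G ⊕[ b ] H) (⊤ ++ T)
    cluster-⊤++ = p₃Free⇒cluster ∘ p₃Free-⊤++ ∘ cluster⇒p₃Free

    cluster-∨ : ∀ {S T} → IsVertexCover (complement G) S → IsVertexCover (complement H) T →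
                IsClusterDeletionSet (G ∨ᴳ H) (S ++ T)
    cluster-∨ coverḠ coverH̄ =
      complete⇒cluster (complete-∨ (coverComplement⇒complete coverḠ) (coverComplement⇒complete coverH̄))

    cluster-∨⇒coverComplementˡ : ∀ {S T} → IsClusterDeletionSet (G ∨ᴳ H) (S ++ T) →
                                 ∀ {j} → j ∉ T → IsVertexCover (complement G) S
    cluster-∨⇒coverComplementˡ cluster =
      complete⇒coverComplement ∘ p₃Free-∨⇒completeˡ (cluster⇒p₃Free cluster)

    cluster-∨⇒coverComplementʳ : ∀ {S T} → IsClusterDeletionSet (G ∨ᴳ H) (S ++ T) →
                                 ∀ {i} → i ∉ S → IsVertexCover (complement H) T
    cluster-∨⇒coverComplementʳ cluster =
      complete⇒coverComplement ∘ p₃Free-∨⇒completeʳ (cluster⇒p₃Free cluster)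

    isTau-∪ : ∀ {t₁ t₂} → IsTau G t₁ → IsTau H t₂ → IsTau (G ∪ᴳ H) (t₁ + t₂)
    isTau-∪ = isMinimum-++ cover-∪ λ cover → cover-restrictˡ cover , cover-restrictʳ cover

    isVarsigma-∪ : ∀ {s₁ s₂} → IsVarsigma G s₁ → IsVarsigma H s₂ → IsVarsigma (G ∪ᴳ H) (s₁ + s₂)
    isVarsigma-∪ = isMinimum-++ cluster-∪ λ cluster → cluster-restrictˡ cluster , cluster-restrictʳ cluster

    isTau-∨ : ∀ {t₁ t₂} → IsTau G t₁ → IsTau H t₂ → IsTau (G ∨ᴳ H) ((t₁ + n) ⊓ (t₂ + m))
    isTau-∨ {t₁} {t₂} ((S₁ , coverS₁ , ∣S₁∣≡t₁) , minG) ((S₂ , coverS₂ , ∣S₂∣≡t₂) , minH) =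
      attains-⊓ (attains-++ S₁ ⊤ (cover-++⊤ coverS₁) ∣S₁∣≡t₁ (∣⊤∣≡n n))
                (subst (Attains _) (+-comm m t₂) (attains-++ ⊤ S₂ (cover-⊤++ coverS₂) (∣⊤∣≡n m) ∣S₂∣≡t₂)) ,
      isLowerBound-++ bound
      where
      bound : ∀ S T → IsVertexCover (G ∨ᴳ H) (S ++ T) → (t₁ + n) ⊓ (t₂ + m) ≤ ∣ S ∣ + ∣ T ∣
      bound S T cover with ⊤⊆-or-∉ T
      ... | inj₁ ⊤⊆T       = m≤n⇒m⊓o≤n (t₂ + m)
        (+-mono-≤ (minG S (cover-restrictˡ cover)) (⊤⊆⇒n≤∣p∣ ⊤⊆T))
      ... | inj₂ (j , j∉T) = m≤n⇒o⊓m≤n (t₁ + n) (subst (_≤ ∣ S ∣ + ∣ T ∣) (+-comm m t₂)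
        (+-mono-≤ (⊤⊆⇒n≤∣p∣ (cover-∨⇒⊤⊆ˡ cover j∉T)) (minH T (cover-restrictʳ cover))))

    isVarsigma-∨ : ∀ {s₁ s₂ c₁ c₂} → IsVarsigma G s₁ → IsVarsigma H s₂ →
                   IsTau (complement G) c₁ → IsTau (complement H) c₂ →
                   IsVarsigma (G ∨ᴳ H) (((s₁ + n) ⊓ (s₂ + m)) ⊓ (c₁ + c₂))
    isVarsigma-∨ {s₁} {s₂} {c₁} {c₂}
                 ((S₁ , clusterS₁ , ∣S₁∣≡s₁) , minG) ((S₂ , clusterS₂ , ∣S₂∣≡s₂) , minH)
                 ((C₁ , coverC₁ , ∣C₁∣≡c₁) , minḠ) ((C₂ , coverC₂ , ∣C₂∣≡c₂) , minH̄) =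
      attains-⊓ (attains-⊓ deleteH deleteG) keepTwoCliques , isLowerBound-++ bound
      where
      deleteH : Attains (IsClusterDeletionSet (G ∨ᴳ H)) (s₁ + n)
      deleteH = attains-++ S₁ ⊤ (cluster-++⊤ clusterS₁) ∣S₁∣≡s₁ (∣⊤∣≡n n)

      deleteG : Attains (IsClusterDeletionSet (G ∨ᴳ H)) (s₂ + m)
      deleteG = subst (Attains _) (+-comm m s₂) (attains-++ ⊤ S₂ (cluster-⊤++ clusterS₂) (∣⊤∣≡n m) ∣S₂∣≡s₂)

      keepTwoCliques : Attains (IsClusterDeletionSet (G ∨ᴳ H)) (c₁ + c₂)
      keepTwoCliques = attains-++ C₁ C₂ (cluster-∨ coverC₁ coverC₂) ∣C₁∣≡c₁ ∣C₂∣≡c₂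

      bound : ∀ S T → IsClusterDeletionSet (G ∨ᴳ H) (S ++ T) →
              ((s₁ + n) ⊓ (s₂ + m)) ⊓ (c₁ + c₂) ≤ ∣ S ∣ + ∣ T ∣
      bound S T cluster with ⊤⊆-or-∉ S | ⊤⊆-or-∉ T
      ... | inj₁ ⊤⊆S       | _              = m≤n⇒m⊓o≤n (c₁ + c₂) (m≤n⇒o⊓m≤n (s₁ + n)
        (subst (_≤ ∣ S ∣ + ∣ T ∣) (+-comm m s₂)
          (+-mono-≤ (⊤⊆⇒n≤∣p∣ ⊤⊆S) (minH T (cluster-restrictʳ cluster)))))
      ... | inj₂ _         | inj₁ ⊤⊆T       = m≤n⇒m⊓o≤n (c₁ + c₂) (m≤n⇒m⊓o≤n (s₂ + m)
        (+-mono-≤ (minG S (cluster-restrictˡ cluster)) (⊤⊆⇒n≤∣p∣ ⊤⊆T)))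
      ... | inj₂ (i , i∉S) | inj₂ (j , j∉T) = m≤n⇒o⊓m≤n ((s₁ + n) ⊓ (s₂ + m))
        (+-mono-≤ (minḠ S (cluster-∨⇒coverComplementˡ cluster j∉T))
                  (minH̄ T (cluster-∨⇒coverComplementʳ cluster i∉S)))

lemma17 : ∀ {m n} (G₁ : Graph m) (G₂ : Graph n) (t₁ t₂ s₁ s₂ c₁ c₂ : ℕ)
    → IsTau G₁ t₁ → IsTau G₂ t₂
    → IsVarsigma G₁ s₁ → IsVarsigma G₂ s₂
    → IsTau (complement G₁) c₁ → IsTau (complement G₂) c₂
    → IsTau (G₁ ∪ᴳ G₂) (t₁ + t₂)
      × IsTau (G₁ ∨ᴳ G₂) ((t₁ + n) ⊓ (t₂ + m))
      × IsVarsigma (G₁ ∪ᴳ G₂) (s₁ + s₂)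
      × IsVarsigma (G₁ ∨ᴳ G₂) (((s₁ + n) ⊓ (s₂ + m)) ⊓ (c₁ + c₂))
lemma17 G₁ G₂ t₁ t₂ s₁ s₂ c₁ c₂ τ₁ τ₂ ς₁ ς₂ τ̄₁ τ̄₂ =
  isTau-∪ τ₁ τ₂ , isTau-∨ τ₁ τ₂ , isVarsigma-∪ ς₁ ς₂ , isVarsigma-∨ ς₁ ς₂ τ̄₁ τ̄₂
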